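{- For all integers $r\ge 1$ and $t\ge 3$, $$\gamma_o(K_{r}\Box C_{t})=\left\lceil\frac{rt}{2}\right\rceil.$$
   Context: All graphs are finite and simple; $K_r$ is the complete graph on $r$ vertices and $C_t$ the cycle on $t$ vertices. For a graph with vertex set $V$, a vertex $v$ and $S\subseteq V$, let $\delta_S(v)=|N(v)\cap S|$ and $\overline{S}=V\setminus S$. A nonempty set $S\subseteq V$ is a global offensive alliance if $\delta_S(v)\ge \delta_{\overline{S}}(v)+1$ for every $v\in\overline{S}$; $\gamma_o(G)$ is the minimum cardinality of a global offensive alliance of $G$. $G\Box H$ is the Cartesian product: vertex set $V(G)\times V(H)$, with $(a,b)\sim(c,d)$ iff ($a=c$ and $b\sim d$ in $H$) or ($a\sim c$ in $G$ and $b=d$). -}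

module Defs where

open import Data.Nat using (ℕ; zero; suc; _+_; _*_; _≥_; _≡ᵇ_; _%_)
open import Data.Nat.Base using (⌈_/2⌉)
open import Data.Bool using (Bool; true; false; not; _∧_; _∨_)
open import Data.Fin using (Fin; toℕ; remQuot)
open import Data.Fin.Properties using (_≟_)
open import Data.Fin.Subset using (Subset; ∣_∣; ∁; _∩_; _∉_; Nonempty)
open import Data.Vec using (tabulate)
open import Data.Product using (_×_; _,_; proj₁; proj₂; Σ)
open import Relation.Nullary.Decidable using (⌊_⌋)
open import Relation.Binary.PropositionalEquality using (_≡_)

-- A finite graph on vertex set Fin order, given by a Boolean adjacency relation.
-- (All graphs used below are simple: adjacency is symmetric and irreflexive.)
record Graph : Set where
  field
    order : ℕ
    adj   : Fin order → Fin order → Bool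
open Graph public

K : ℕ → Graph
K r = record { order = r ; adj = λ i j → not ⌊ i ≟ j ⌋ }

C : ℕ → Graph
C zero    = record { order = zero ; adj = λ () }
C (suc k) = record { order = suc k
                   ; adj = λ i j → (suc (toℕ i) % suc k ≡ᵇ toℕ j)
                                 ∨ (suc (toℕ j) % suc k ≡ᵇ toℕ i) }

-- Cartesian product G □ H; vertex (a , b) is encoded as combine a b : Fin (|G| * |H|)
_□_ : Graph → Graph → Graph
G □ H = record
  { order = order G * order H
  ; adj = λ x y →
      let p = remQuot (order H) x ; q = remQuot (order H) y
          a = proj₁ p ; b = proj₂ p ; c = proj₁ q ; d = proj₂ q
      in (⌊ a ≟ c ⌋ ∧ adj H b d) ∨ (adj G a c ∧ ⌊ b ≟ d ⌋) }

N : (G : Graph) → Fin (order G) → Subset (order G)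
N G v = tabulate (adj G v)

δ : (G : Graph) → Subset (order G) → Fin (order G) → ℕ
δ G S v = ∣ N G v ∩ S ∣

IsGlobalOffensiveAlliance : (G : Graph) → Subset (order G) → Set
IsGlobalOffensiveAlliance G S =
  Nonempty S × (∀ v → v ∉ S → δ G S v ≥ suc (δ G (∁ S) v))

OffensiveAllianceNumber : Graph → ℕ → Set
OffensiveAllianceNumber G k =
  Σ (Subset (order G)) (λ S → IsGlobalOffensiveAlliance G S × ∣ S ∣ ≡ k)
  × (∀ S → IsGlobalOffensiveAlliance G S → ∣ S ∣ ≥ k)

module Submission where

-- Write a vertex of K_r □ C_t as (a , b), a row of K_r and a column of C_t. Its neighbours
-- are the other r - 1 vertices of column b and the cycle-neighbours of b in row a, so for
-- v ∉ S the offensive condition reads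
--   |column b ∖ S| + |row-neighbours ∉ S| ≤ |column b ∩ S| + |row-neighbours ∈ S|,
-- v itself being counted on the left.
--
-- Lower bound: take consecutive columns b, b + 1. If some row a misses S in both, then
-- (a , b) and (a , b + 1) each have a row-neighbour outside S, hence at most one inside, so
-- S holds at least half of each of the two columns; otherwise every row meets S there.
-- Either way the two columns contain at least r vertices of S, and summing over the t
-- pairs of consecutive columns gives 2 |S| ≥ r t.
--
-- Upper bound: the checkerboard {(a , b) : a + b even} has ⌈ r t / 2 ⌉ vertices. For
-- (a , b) outside it, column b is split ⌈r/2⌉ : ⌊r/2⌋ in favour of the checkerboard when b
-- is even, and against it by at most one vertex when b is odd; in row a, b always has a
-- neighbour of the other parity, and when b is odd both of its neighbours are even (the
-- only edge not of the form b ~ b + 1 is t - 1 ~ 0).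

open import Defs
open import Data.Nat using (ℕ; zero; suc; _+_; _*_; _≤_; _≥_; _≡ᵇ_; _%_; z≤n; s≤s; ⌈_/2⌉; ⌊_/2⌋)
open import Data.Nat.Properties hiding (_≟_)
open import Data.Nat.DivMod using (m%n<n; m<n⇒m%n≡m; n%n≡0)
open import Data.Bool using (Bool; true; false; not; _∧_; _∨_; if_then_else_)
open import Data.Bool.Properties using (∨-comm; ∨-identityʳ; not-involutive) renaming (_≟_ to _≟ᵇ_)
open import Data.Fin
  using (Fin; zero; suc; toℕ; fromℕ; fromℕ<; inject₁; punchIn; combine; quotient; remainder; _↑ˡ_; _↑ʳ_)
open import Data.Fin.Properties
  using ( _≟_; any?; toℕ-injective; toℕ<n; toℕ-fromℕ; toℕ-fromℕ<; toℕ-inject₁; punchInᵢ≢i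
        ; remQuot-combine; combine-remQuot)
open import Data.Fin.Subset using (Subset; ∣_∣; ∁; _∩_; _∉_; Nonempty)
open import Data.Vec using ([]; _∷_; lookup; tabulate)
open import Data.Vec.Properties using (lookup∘tabulate; lookup-map; lookup-zipWith; lookup⇒[]=; []=⇒lookup)
open import Data.Vec.Functional using (removeAt)
open import Data.Product using (_×_; _,_; proj₁; proj₂; ∃)
open import Data.Sum using (_⊎_; inj₁; inj₂)
open import Function using (_∘_; _⇔_; mk⇔; Equivalence)
open import Relation.Nullary using (¬_; Dec; yes; no; contradiction)
open import Relation.Nullary.Decidable using (⌊_⌋; dec-true; dec-false; isYes≗does; ⌊⌋-map′; _×-dec_)
open import Relation.Binary.PropositionalEquality
open import Algebra.Properties.CommutativeSemigroup +-commutativeSemigroup using (interchange; xy∙z≈zy∙x)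
open import Algebra.Properties.CommutativeMonoid.Sum +-0-commutativeMonoid
  using (sum; sum-syntax; sum-cong-≗; sum-replicate-zero; sum-init-last; sum-remove; ∑-distrib-+; ∑-comm)

𝟙 : Bool → ℕ
𝟙 true  = 1
𝟙 false = 0

𝟙-not : ∀ x → 𝟙 x + 𝟙 (not x) ≡ 1
𝟙-not true  = refl
𝟙-not false = refl

𝟙-∨ : ∀ x y → 𝟙 (x ∨ y) ≤ 𝟙 x + 𝟙 y
𝟙-∨ true  y = s≤s z≤n
𝟙-∨ false y = ≤-refl

∑-const : ∀ n c → ∑[ i < n ] c ≡ n * c
∑-const zero    c = refl
∑-const (suc n) c = cong (c +_) (∑-const n c)

∑-mono-≤ : ∀ {n} {f g : Fin n → ℕ} → (∀ i → f i ≤ g i) → sum f ≤ sum g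
∑-mono-≤ {zero}  f≤g = z≤n
∑-mono-≤ {suc n} f≤g = +-mono-≤ (f≤g zero) (∑-mono-≤ (f≤g ∘ suc))

*≤∑ : ∀ {n c} {f : Fin n → ℕ} → (∀ i → c ≤ f i) → n * c ≤ sum f
*≤∑ {n} {c} c≤f = subst (_≤ _) (∑-const n c) (∑-mono-≤ c≤f)

term≤∑ : ∀ {n} (f : Fin n → ℕ) i → f i ≤ sum f
term≤∑ f zero    = m≤m+n _ _
term≤∑ f (suc i) = ≤-trans (term≤∑ (f ∘ suc) i) (m≤n+m _ _)

∑-agree-except : ∀ {n} (f g : Fin n → ℕ) a → (∀ c → a ≢ c → f c ≡ g c) → sum f + g a ≡ sum g + f a
∑-agree-except {suc n} f g a f≡g = begin
  sum f + g a                    ≡⟨ cong (_+ g a) (sum-remove f) ⟩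
  f a + sum (removeAt f a) + g a ≡⟨ cong (λ s → f a + s + g a) (sum-cong-≗ f≡g-off-a) ⟩
  f a + sum (removeAt g a) + g a ≡⟨ xy∙z≈zy∙x (f a) _ (g a) ⟩
  g a + sum (removeAt g a) + f a ≡⟨ cong (_+ f a) (sum-remove g) ⟨
  sum g + f a                    ∎
  where
  open ≡-Reasoning
  f≡g-off-a : ∀ i → f (punchIn a i) ≡ g (punchIn a i)
  f≡g-off-a i = f≡g (punchIn a i) (punchInᵢ≢i a i ∘ sym)

∑-single : ∀ {n} (f : Fin n → ℕ) a → (∀ c → a ≢ c → f c ≡ 0) → sum f ≡ f a
∑-single {n} f a f≡0 = begin
  sum f                   ≡⟨ +-identityʳ (sum f) ⟨
  sum f + 0               ≡⟨ ∑-agree-except f (λ _ → 0) a f≡0 ⟩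
  sum {n} (λ _ → 0) + f a ≡⟨ cong (_+ f a) (sum-replicate-zero n) ⟩
  f a                     ∎
  where open ≡-Reasoning

∑-↑ : ∀ m {n} (f : Fin (m + n) → ℕ) → sum f ≡ sum (f ∘ (_↑ˡ n)) + sum (f ∘ (m ↑ʳ_))
∑-↑ zero    f = refl
∑-↑ (suc m) f = trans (cong (f zero +_) (∑-↑ m (f ∘ suc))) (sym (+-assoc (f zero) _ _))

∑-combine : ∀ m {n} (f : Fin (m * n) → ℕ) → sum f ≡ ∑[ a < m ] ∑[ b < n ] f (combine a b)
∑-combine zero        f = refl
∑-combine (suc m) {n} f =
  trans (∑-↑ n f) (cong (sum (f ∘ (_↑ˡ m * n)) +_) (∑-combine m (f ∘ (n ↑ʳ_))))

∣∣≡∑ : ∀ {n} (S : Subset n) → ∣ S ∣ ≡ ∑[ i < n ] 𝟙 (lookup S i)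
∣∣≡∑ []          = refl
∣∣≡∑ (true  ∷ S) = cong suc (∣∣≡∑ S)
∣∣≡∑ (false ∷ S) = ∣∣≡∑ S

∑-∁-split : ∀ {m n} (p : Fin n → Bool) (S : Subset m) (f : Fin n → Fin m) →
  ∑[ i < n ] 𝟙 (p i ∧ lookup S (f i)) + ∑[ i < n ] 𝟙 (p i ∧ lookup (∁ S) (f i)) ≡ ∑[ i < n ] 𝟙 (p i)
∑-∁-split p S f = trans (sym (∑-distrib-+ (λ i → 𝟙 (p i ∧ lookup S (f i))) _)) (sum-cong-≗ split)
  where
  𝟙-∧-split : ∀ x y → 𝟙 (x ∧ y) + 𝟙 (x ∧ not y) ≡ 𝟙 x
  𝟙-∧-split true  y = 𝟙-not y
  𝟙-∧-split false y = refl
  split : ∀ i → 𝟙 (p i ∧ lookup S (f i)) + 𝟙 (p i ∧ lookup (∁ S) (f i)) ≡ 𝟙 (p i)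
  split i rewrite lookup-map (f i) not S = 𝟙-∧-split (p i) (lookup S (f i))

⌈n+[n+m]/2⌉≡n+⌈m/2⌉ : ∀ n m → ⌈ n + (n + m) /2⌉ ≡ n + ⌈ m /2⌉
⌈n+[n+m]/2⌉≡n+⌈m/2⌉ zero    m = refl
⌈n+[n+m]/2⌉≡n+⌈m/2⌉ (suc n) m =
  trans (cong (λ k → ⌈ suc k /2⌉) (+-suc n (n + m))) (cong suc (⌈n+[n+m]/2⌉≡n+⌈m/2⌉ n m))

⌈n/2⌉≤⌊n/2⌋+1 : ∀ n → ⌈ n /2⌉ ≤ ⌊ n /2⌋ + 1
⌈n/2⌉≤⌊n/2⌋+1 zero          = z≤n
⌈n/2⌉≤⌊n/2⌋+1 (suc zero)    = s≤s z≤n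
⌈n/2⌉≤⌊n/2⌋+1 (suc (suc n)) = s≤s (⌈n/2⌉≤⌊n/2⌋+1 n)

n≤m+m⇒⌈n/2⌉≤m : ∀ {n} m → n ≤ m + m → ⌈ n /2⌉ ≤ m
n≤m+m⇒⌈n/2⌉≤m m n≤m+m = ≤-trans (⌈n/2⌉-mono n≤m+m) (≤-reflexive (sym (n≡⌈n+n/2⌉ m)))

1≤m⇒m+n≤2⇒n≤m : ∀ {m n} → 1 ≤ m → m + n ≤ 2 → n ≤ m
1≤m⇒m+n≤2⇒n≤m {m} {n} 1≤m m+n≤2 = ≤-trans (≤-pred (≤-trans (+-monoˡ-≤ n 1≤m) m+n≤2)) 1≤m

majorities⇒≤ : ∀ {r s s̄ t t̄} → s + s̄ ≡ r → t + t̄ ≡ r → s̄ ≤ s → t̄ ≤ t → r ≤ s + t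
majorities⇒≤ {r} {s} {s̄} {t} {t̄} s+s̄≡r t+t̄≡r s̄≤s t̄≤t =
  subst (_≤ s + t) (sym (n≡⌈n+n/2⌉ r)) (n≤m+m⇒⌈n/2⌉≤m (s + t) (begin
    r + r             ≡⟨ cong₂ _+_ s+s̄≡r t+t̄≡r ⟨
    (s + s̄) + (t + t̄) ≤⟨ +-mono-≤ (+-monoʳ-≤ s s̄≤s) (+-monoʳ-≤ t t̄≤t) ⟩
    (s + s) + (t + t) ≡⟨ interchange s s t t ⟩
    (s + t) + (s + t) ∎))
  where open ≤-Reasoning

count-alternating : ∀ (g : ℕ → Bool) → (∀ m → g (suc m) ≡ not (g m)) →
  ∀ n → ∑[ i < n ] 𝟙 (g (toℕ i)) ≡ (if g 0 then ⌈ n /2⌉ else ⌊ n /2⌋)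
count-alternating g alt zero with g 0
... | true  = refl
... | false = refl
count-alternating g alt (suc n) with g 0 in g0 | count-alternating (λ m → g (suc m)) (λ m → alt (suc m)) n
... | true  | count = cong suc (trans count (cong (λ x → if x then _ else _) (trans (alt 0) (cong not g0))))
... | false | count = trans count (cong (λ x → if x then _ else _) (trans (alt 0) (cong not g0)))

∑-alternating : ∀ {n} (g : ℕ → ℕ) → (∀ m → g m + g (suc m) ≡ n) → g 0 ≡ ⌈ n /2⌉ →
  ∀ r → ∑[ a < r ] g (toℕ a) ≡ ⌈ r * n /2⌉
∑-alternating     g pair g0 zero          = refl
∑-alternating {n} g pair g0 (suc zero)    =
  trans (+-identityʳ (g 0)) (trans g0 (cong ⌈_/2⌉ (sym (+-identityʳ n))))
∑-alternating {n} g pair g0 (suc (suc r)) = begin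
  g 0 + (g 1 + ∑[ a < r ] g (2 + toℕ a))
    ≡⟨ +-assoc (g 0) (g 1) _ ⟨
  g 0 + g 1 + ∑[ a < r ] g (2 + toℕ a)
    ≡⟨ cong₂ _+_ (pair 0) (∑-alternating (g ∘ (2 +_)) (pair ∘ (2 +_)) g2≡g0 r) ⟩
  n + ⌈ r * n /2⌉
    ≡⟨ ⌈n+[n+m]/2⌉≡n+⌈m/2⌉ n (r * n) ⟨
  ⌈ n + (n + r * n) /2⌉
    ∎
  where
  open ≡-Reasoning
  g2≡g0 : g 2 ≡ ⌈ n /2⌉
  g2≡g0 = trans (+-cancelˡ-≡ (g 1) _ _ (trans (pair 1) (trans (sym (pair 0)) (+-comm (g 0) (g 1))))) g0

even : ℕ → Bool
even zero    = true
even (suc n) = not (even n)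

even-+-flip : ∀ m {n n′} → even n′ ≡ not (even n) → even (m + n′) ≡ not (even (m + n))
even-+-flip zero    e = e
even-+-flip (suc m) e = cong not (even-+-flip m e)

∉⇒lookup≡false : ∀ {n} {S : Subset n} {x} → x ∉ S → lookup S x ≡ false
∉⇒lookup≡false {S = S} {x} x∉S with lookup S x in eq
... | true  = contradiction (lookup⇒[]= x S eq) x∉S
... | false = refl

lookup≡false⇒∉ : ∀ {n} {S : Subset n} {x} → lookup S x ≡ false → x ∉ S
lookup≡false⇒∉ eq x∈S with trans (sym ([]=⇒lookup x∈S)) eq
... | ()

⌊≟⌋-refl : ∀ {n} (i : Fin n) → ⌊ i ≟ i ⌋ ≡ true
⌊≟⌋-refl i = trans (isYes≗does (i ≟ i)) (dec-true (i ≟ i) refl)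

⌊≟⌋-≢ : ∀ {n} {i j : Fin n} → i ≢ j → ⌊ i ≟ j ⌋ ≡ false
⌊≟⌋-≢ {i = i} {j} i≢j = trans (isYes≗does (i ≟ j)) (dec-false (i ≟ j) i≢j)

module KProduct (r : ℕ) (H : Graph) where

  column : Subset (r * order H) → Fin (order H) → ℕ
  column S b = ∑[ c < r ] 𝟙 (lookup S (combine c b))

  rowNeighbours : Subset (r * order H) → Fin r → Fin (order H) → ℕ
  rowNeighbours S a b = ∑[ d < order H ] 𝟙 (adj H b d ∧ lookup S (combine a d))

  adj-K□ : ∀ a b c d → adj (K r □ H) (combine a b) (combine c d)
                     ≡ (⌊ a ≟ c ⌋ ∧ adj H b d) ∨ (not ⌊ a ≟ c ⌋ ∧ ⌊ b ≟ d ⌋)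
  adj-K□ a b c d = cong₂ adjacent (remQuot-combine a b) (remQuot-combine c d)
    where
    adjacent : Fin r × Fin (order H) → Fin r × Fin (order H) → Bool
    adjacent (a , b) (c , d) = (⌊ a ≟ c ⌋ ∧ adj H b d) ∨ (not ⌊ a ≟ c ⌋ ∧ ⌊ b ≟ d ⌋)

  adj-K□-row : ∀ a b d → adj (K r □ H) (combine a b) (combine a d) ≡ adj H b d
  adj-K□-row a b d rewrite adj-K□ a b a d | ⌊≟⌋-refl a = ∨-identityʳ (adj H b d)

  adj-K□-column : ∀ {a c} b d → a ≢ c → adj (K r □ H) (combine a b) (combine c d) ≡ ⌊ b ≟ d ⌋
  adj-K□-column {a} {c} b d a≢c rewrite adj-K□ a b c d | ⌊≟⌋-≢ a≢c = refl

  δ≡∑ : ∀ S v → δ (K r □ H) S v ≡ ∑[ y < r * order H ] 𝟙 (adj (K r □ H) v y ∧ lookup S y)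
  δ≡∑ S v = trans (∣∣≡∑ (N (K r □ H) v ∩ S)) (sum-cong-≗ λ y → cong 𝟙
    (trans (lookup-zipWith _∧_ y (N (K r □ H) v) S) (cong (_∧ lookup S y) (lookup∘tabulate _ y))))

  δ-K□ : ∀ S a b → δ (K r □ H) S (combine a b) + 𝟙 (lookup S (combine a b))
                 ≡ column S b + rowNeighbours S a b
  δ-K□ S a b = begin
    δ (K r □ H) S (combine a b) + 𝟙 (lookup S (combine a b))
      ≡⟨ cong (_+ 𝟙 (lookup S (combine a b))) (trans (δ≡∑ S (combine a b)) (∑-combine r _)) ⟩
    ∑[ c < r ] row c + 𝟙 (lookup S (combine a b))
      ≡⟨ ∑-agree-except row (λ c → 𝟙 (lookup S (combine c b))) a other-row ⟩
    column S b + row a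
      ≡⟨ cong (column S b +_) (sum-cong-≗ λ d → cong (λ x → 𝟙 (x ∧ _)) (adj-K□-row a b d)) ⟩
    column S b + rowNeighbours S a b
      ∎
    where
    open ≡-Reasoning
    row : Fin r → ℕ
    row c = ∑[ d < order H ] 𝟙 (adj (K r □ H) (combine a b) (combine c d) ∧ lookup S (combine c d))
    other-row : ∀ c → a ≢ c → row c ≡ 𝟙 (lookup S (combine c b))
    other-row c a≢c = begin
      row c
        ≡⟨ ∑-single _ b (λ d b≢d →
             cong (λ x → 𝟙 (x ∧ _)) (trans (adj-K□-column b d a≢c) (⌊≟⌋-≢ b≢d))) ⟩
      𝟙 (adj (K r □ H) (combine a b) (combine c b) ∧ lookup S (combine c b))
        ≡⟨ cong (λ x → 𝟙 (x ∧ _)) (trans (adj-K□-column b b a≢c) (⌊≟⌋-refl b)) ⟩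
      𝟙 (lookup S (combine c b))
        ∎

  offensive-at⇔ : ∀ S a b → lookup S (combine a b) ≡ false →
    (δ (K r □ H) S (combine a b) ≥ suc (δ (K r □ H) (∁ S) (combine a b)))
      ⇔ (column (∁ S) b + rowNeighbours (∁ S) a b ≤ column S b + rowNeighbours S a b)
  offensive-at⇔ S a b v∉S = mk⇔ (subst₂ _≤_ δ∁S δS) (subst₂ _≤_ (sym δ∁S) (sym δS))
    where
    v = combine a b
    δS : δ (K r □ H) S v ≡ column S b + rowNeighbours S a b
    δS = trans (sym (+-identityʳ _))
               (trans (cong (λ x → δ (K r □ H) S v + 𝟙 x) (sym v∉S)) (δ-K□ S a b))
    v∈∁S : lookup (∁ S) v ≡ true
    v∈∁S = trans (lookup-map v not S) (cong not v∉S)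
    δ∁S : suc (δ (K r □ H) (∁ S) v) ≡ column (∁ S) b + rowNeighbours (∁ S) a b
    δ∁S = trans (+-comm 1 _)
                (trans (cong (λ x → δ (K r □ H) (∁ S) v + 𝟙 x) (sym v∈∁S)) (δ-K□ (∁ S) a b))

  column-∁ : ∀ S b → column S b + column (∁ S) b ≡ r
  column-∁ S b =
    trans (∑-∁-split (λ _ → true) S (λ (c : Fin r) → combine c b)) (trans (∑-const r 1) (*-identityʳ r))

  rowNeighbours-∁ : ∀ S a b → rowNeighbours S a b + rowNeighbours (∁ S) a b ≡ ∑[ d < order H ] 𝟙 (adj H b d)
  rowNeighbours-∁ S a b = ∑-∁-split (adj H b) S (combine a)

  ∣∣≡∑column : ∀ S → ∣ S ∣ ≡ ∑[ b < order H ] column S b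
  ∣∣≡∑column S =
    trans (∣∣≡∑ S) (trans (∑-combine r _) (∑-comm (λ (c : Fin r) b → 𝟙 (lookup S (combine c b)))))

next : ∀ {k} → Fin (suc k) → Fin (suc k)
next {k} b = fromℕ< (m%n<n (suc (toℕ b)) (suc k))

toℕ-next : ∀ {k} (b : Fin (suc k)) → toℕ (next b) ≡ suc (toℕ b) % suc k
toℕ-next b = toℕ-fromℕ< _

toℕ-next-cases : ∀ {k} (b : Fin (suc k)) → toℕ (next b) ≡ suc (toℕ b) ⊎ toℕ (next b) ≡ 0
toℕ-next-cases {k} b with m≤n⇒m<n∨m≡n (toℕ<n b)
... | inj₁ 1+b<1+k = inj₁ (trans (toℕ-next b) (m<n⇒m%n≡m 1+b<1+k))
... | inj₂ 1+b≡1+k = inj₂ (trans (toℕ-next b) (trans (cong (_% suc k) 1+b≡1+k) (n%n≡0 (suc k))))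

next-inject₁ : ∀ {k} (i : Fin k) → next (inject₁ i) ≡ suc i
next-inject₁ {k} i = toℕ-injective (begin
  toℕ (next (inject₁ i))        ≡⟨ toℕ-next (inject₁ i) ⟩
  suc (toℕ (inject₁ i)) % suc k ≡⟨ cong (λ m → suc m % suc k) (toℕ-inject₁ i) ⟩
  suc (toℕ i) % suc k           ≡⟨ m<n⇒m%n≡m (s≤s (toℕ<n i)) ⟩
  suc (toℕ i)                   ∎)
  where open ≡-Reasoning

next-fromℕ : ∀ k → next (fromℕ k) ≡ zero
next-fromℕ k = toℕ-injective (begin
  toℕ (next (fromℕ k))        ≡⟨ toℕ-next (fromℕ k) ⟩
  suc (toℕ (fromℕ k)) % suc k ≡⟨ cong (λ m → suc m % suc k) (toℕ-fromℕ k) ⟩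
  suc k % suc k               ≡⟨ n%n≡0 (suc k) ⟩
  0                           ∎)
  where open ≡-Reasoning

∑-rotate : ∀ {k} (f : Fin (suc k) → ℕ) → ∑[ b < suc k ] f (next b) ≡ sum f
∑-rotate {k} f = begin
  sum (f ∘ next)                                ≡⟨ sum-init-last (f ∘ next) ⟩
  sum (f ∘ next ∘ inject₁) + f (next (fromℕ k)) ≡⟨ cong₂ _+_ (sum-cong-≗ (cong f ∘ next-inject₁))
                                                              (cong f (next-fromℕ k)) ⟩
  sum (f ∘ suc) + f zero                        ≡⟨ +-comm (sum (f ∘ suc)) (f zero) ⟩
  sum f                                         ∎
  where open ≡-Reasoning

toℕ-≡ᵇ : ∀ {n} (i j : Fin n) → (toℕ i ≡ᵇ toℕ j) ≡ ⌊ i ≟ j ⌋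
toℕ-≡ᵇ zero    zero    = refl
toℕ-≡ᵇ zero    (suc j) = refl
toℕ-≡ᵇ (suc i) zero    = refl
toℕ-≡ᵇ (suc i) (suc j) = trans (toℕ-≡ᵇ i j) (sym (⌊⌋-map′ _ _ (i ≟ j)))

adj-C : ∀ {k} (b d : Fin (suc k)) → adj (C (suc k)) b d ≡ ⌊ next b ≟ d ⌋ ∨ ⌊ next d ≟ b ⌋
adj-C b d = cong₂ _∨_ (next-≡ᵇ b d) (next-≡ᵇ d b)
  where
  next-≡ᵇ : ∀ {k} (b d : Fin (suc k)) → (suc (toℕ b) % suc k ≡ᵇ toℕ d) ≡ ⌊ next b ≟ d ⌋
  next-≡ᵇ b d = trans (cong (_≡ᵇ toℕ d) (sym (toℕ-next b))) (toℕ-≡ᵇ (next b) d)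

adj-C-sym : ∀ {k} (b d : Fin (suc k)) → adj (C (suc k)) b d ≡ adj (C (suc k)) d b
adj-C-sym {k} b d = ∨-comm (suc (toℕ b) % suc k ≡ᵇ toℕ d) _

adj-C⇒next : ∀ {k} (b d : Fin (suc k)) → adj (C (suc k)) b d ≡ true → next b ≡ d ⊎ next d ≡ b
adj-C⇒next b d b~d with next b ≟ d | next d ≟ b | adj-C b d
... | yes b→d | _       | _    = inj₁ b→d
... | no _    | yes d→b | _    = inj₂ d→b
... | no _    | no _    | adj≡ = contradiction (trans (sym adj≡) b~d) λ ()

adj-next : ∀ {k} (b : Fin (suc k)) → adj (C (suc k)) b (next b) ≡ true
adj-next b = trans (adj-C b (next b)) (cong (_∨ ⌊ next (next b) ≟ b ⌋) (⌊≟⌋-refl (next b)))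

adj-inject₁-suc : ∀ {k} (i : Fin k) → adj (C (suc k)) (inject₁ i) (suc i) ≡ true
adj-inject₁-suc {k} i =
  subst (λ d → adj (C (suc k)) (inject₁ i) d ≡ true) (next-inject₁ i) (adj-next (inject₁ i))

degree-C≤2 : ∀ {k} (b : Fin (suc k)) → ∑[ d < suc k ] 𝟙 (adj (C (suc k)) b d) ≤ 2
degree-C≤2 {k} b = begin
  ∑[ d < suc k ] 𝟙 (adj (C (suc k)) b d)
    ≡⟨ sum-cong-≗ (cong 𝟙 ∘ adj-C b) ⟩
  ∑[ d < suc k ] 𝟙 (⌊ next b ≟ d ⌋ ∨ ⌊ next d ≟ b ⌋)
    ≤⟨ ∑-mono-≤ (λ d → 𝟙-∨ ⌊ next b ≟ d ⌋ ⌊ next d ≟ b ⌋) ⟩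
  ∑[ d < suc k ] (𝟙 ⌊ next b ≟ d ⌋ + 𝟙 ⌊ next d ≟ b ⌋)
    ≡⟨ ∑-distrib-+ (λ d → 𝟙 ⌊ next b ≟ d ⌋) (λ d → 𝟙 ⌊ next d ≟ b ⌋) ⟩
  ∑[ d < suc k ] 𝟙 ⌊ next b ≟ d ⌋ + ∑[ d < suc k ] 𝟙 ⌊ next d ≟ b ⌋
    ≡⟨ cong (∑[ d < suc k ] 𝟙 ⌊ next b ≟ d ⌋ +_) (∑-rotate (λ d → 𝟙 ⌊ d ≟ b ⌋)) ⟩
  ∑[ d < suc k ] 𝟙 ⌊ next b ≟ d ⌋ + ∑[ d < suc k ] 𝟙 ⌊ d ≟ b ⌋
    ≡⟨ cong₂ _+_ (unique (next b ≟_) (next b) (⌊≟⌋-refl (next b)) (λ _ → ⌊≟⌋-≢))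
                 (unique (_≟ b) b (⌊≟⌋-refl b) (λ _ b≢d → ⌊≟⌋-≢ (b≢d ∘ sym))) ⟩
  2 ∎
  where
  open ≤-Reasoning
  unique : ∀ {P : Fin (suc k) → Set} (P? : ∀ d → Dec (P d)) c → ⌊ P? c ⌋ ≡ true →
           (∀ d → c ≢ d → ⌊ P? d ⌋ ≡ false) → ∑[ d < suc k ] 𝟙 ⌊ P? d ⌋ ≡ 1
  unique P? c yes-c no-d = trans (∑-single _ c λ d c≢d → cong 𝟙 (no-d d c≢d)) (cong 𝟙 yes-c)

opposite-parity-neighbour : ∀ {k} (b : Fin (suc (suc k))) →
  ∃ λ d → adj (C (suc (suc k))) b d ≡ true × even (toℕ d) ≡ not (even (toℕ b))
opposite-parity-neighbour {k} zero    = suc zero , adj-inject₁-suc {suc k} zero , refl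
opposite-parity-neighbour     (suc i) =
  inject₁ i , trans (adj-C-sym (suc i) (inject₁ i)) (adj-inject₁-suc i) ,
  trans (cong even (toℕ-inject₁ i)) (sym (not-involutive _))

odd-neighbours-even : ∀ {k} (b d : Fin (suc k)) →
  even (toℕ b) ≡ false → adj (C (suc k)) b d ≡ true → even (toℕ d) ≡ true
odd-neighbours-even b d b-odd b~d with adj-C⇒next b d b~d
... | inj₁ refl with toℕ-next-cases b
...   | inj₁ eq = trans (cong even eq) (cong not b-odd)
...   | inj₂ eq = cong even eq
odd-neighbours-even b d b-odd b~d | inj₂ refl with toℕ-next-cases d
...   | inj₁ eq = trans (sym (not-involutive _)) (cong not (trans (cong even (sym eq)) b-odd))
...   | inj₂ eq = contradiction (trans (cong even (sym eq)) b-odd) λ ()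

module KCycle (r k : ℕ) where

  open KProduct r (C (suc k)) public

  rowNeighbours≤2 : ∀ S a b → rowNeighbours S a b + rowNeighbours (∁ S) a b ≤ 2
  rowNeighbours≤2 S a b = ≤-trans (≤-reflexive (rowNeighbours-∁ S a b)) (degree-C≤2 b)

  majority-at-gap : ∀ {S} → IsGlobalOffensiveAlliance (K r □ C (suc k)) S → ∀ {a b b′} →
    lookup S (combine a b) ≡ false → adj (C (suc k)) b b′ ≡ true → lookup S (combine a b′) ≡ false →
    column (∁ S) b ≤ column S b
  majority-at-gap {S} (_ , offensive) {a} {b} {b′} ab∉S b~b′ ab′∉S = +-cancelʳ-≤ y _ _ (begin
    column (∁ S) b + y ≤⟨ Equivalence.to (offensive-at⇔ S a b ab∉S) (offensive _ (lookup≡false⇒∉ ab∉S)) ⟩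
    column S b + x     ≤⟨ +-monoʳ-≤ (column S b) x≤y ⟩
    column S b + y     ∎)
    where
    open ≤-Reasoning
    x = rowNeighbours S a b
    y = rowNeighbours (∁ S) a b
    1≤y : 1 ≤ y
    1≤y = subst (_≤ y)
      (cong₂ (λ p q → 𝟙 (p ∧ q)) b~b′ (trans (lookup-map (combine a b′) not S) (cong not ab′∉S)))
      (term≤∑ (λ d → 𝟙 (adj (C (suc k)) b d ∧ lookup (∁ S) (combine a d))) b′)
    x≤y : x ≤ y
    x≤y = 1≤m⇒m+n≤2⇒n≤m 1≤y (subst (_≤ 2) (+-comm x y) (rowNeighbours≤2 S a b))

  adjacent-columns : ∀ {S} → IsGlobalOffensiveAlliance (K r □ C (suc k)) S →
    ∀ b → r ≤ column S b + column S (next b)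
  adjacent-columns {S} alliance b
    with any? (λ (a : Fin r) → (lookup S (combine a b) ≟ᵇ false) ×-dec (lookup S (combine a (next b)) ≟ᵇ false))
  ... | yes (a , ab∉S , ab′∉S) = majorities⇒≤ (column-∁ S b) (column-∁ S (next b))
    (majority-at-gap alliance ab∉S (adj-next b) ab′∉S)
    (majority-at-gap alliance ab′∉S (trans (adj-C-sym (next b) b) (adj-next b)) ab∉S)
  ... | no no-gap = begin
    r
      ≡⟨ *-identityʳ r ⟨
    r * 1
      ≤⟨ *≤∑ (λ a → 1≤𝟙+𝟙 _ _ (λ gap → no-gap (a , gap))) ⟩
    ∑[ a < r ] (𝟙 (lookup S (combine a b)) + 𝟙 (lookup S (combine a (next b))))
      ≡⟨ ∑-distrib-+ (λ (a : Fin r) → 𝟙 (lookup S (combine a b))) _ ⟩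
    column S b + column S (next b)
      ∎
    where
    open ≤-Reasoning
    1≤𝟙+𝟙 : ∀ x y → ¬ (x ≡ false × y ≡ false) → 1 ≤ 𝟙 x + 𝟙 y
    1≤𝟙+𝟙 true  _     _       = s≤s z≤n
    1≤𝟙+𝟙 false true  _       = s≤s z≤n
    1≤𝟙+𝟙 false false no-both = contradiction (refl , refl) no-both

  lower-bound : ∀ S → IsGlobalOffensiveAlliance (K r □ C (suc k)) S → ∣ S ∣ ≥ ⌈ r * suc k /2⌉
  lower-bound S alliance = n≤m+m⇒⌈n/2⌉≤m ∣ S ∣ (begin
    r * suc k
      ≡⟨ *-comm r (suc k) ⟩
    suc k * r
      ≤⟨ *≤∑ (adjacent-columns alliance) ⟩
    ∑[ b < suc k ] (column S b + column S (next b))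
      ≡⟨ ∑-distrib-+ (column S) (column S ∘ next) ⟩
    ∑[ b < suc k ] column S b + ∑[ b < suc k ] column S (next b)
      ≡⟨ cong (sum (column S) +_) (∑-rotate (column S)) ⟩
    ∑[ b < suc k ] column S b + ∑[ b < suc k ] column S b
      ≡⟨ cong₂ _+_ (∣∣≡∑column S) (∣∣≡∑column S) ⟨
    ∣ S ∣ + ∣ S ∣
      ∎)
    where open ≤-Reasoning

checkerboard : ∀ r n → Subset (r * n)
checkerboard r n = tabulate λ v → even (toℕ (quotient {r} n v) + toℕ (remainder {r} n v))

lookup-checkerboard : ∀ {r n} (a : Fin r) (b : Fin n) →
  lookup (checkerboard r n) (combine a b) ≡ even (toℕ a + toℕ b)
lookup-checkerboard a b = trans (lookup∘tabulate _ (combine a b))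
  (cong (λ ab → even (toℕ (proj₁ ab) + toℕ (proj₂ ab))) (remQuot-combine a b))

checkerboard-nonempty : ∀ {r n} → Nonempty (checkerboard (suc r) (suc n))
checkerboard-nonempty {r} {n} = combine {suc r} {suc n} zero zero ,
  lookup⇒[]= _ (checkerboard (suc r) (suc n)) (lookup-checkerboard {suc r} {suc n} zero zero)

∣checkerboard∣ : ∀ r n → ∣ checkerboard r n ∣ ≡ ⌈ r * n /2⌉
∣checkerboard∣ r n = begin
  ∣ checkerboard r n ∣
    ≡⟨ ∣∣≡∑ (checkerboard r n) ⟩
  ∑[ v < r * n ] 𝟙 (lookup (checkerboard r n) v)
    ≡⟨ ∑-combine r _ ⟩
  ∑[ a < r ] ∑[ b < n ] 𝟙 (lookup (checkerboard r n) (combine a b))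
    ≡⟨ sum-cong-≗ (λ (a : Fin r) → sum-cong-≗ λ (b : Fin n) → cong 𝟙 (lookup-checkerboard a b)) ⟩
  ∑[ a < r ] row (toℕ a)
    ≡⟨ ∑-alternating row rows-pair (count-alternating even (λ _ → refl) n) r ⟩
  ⌈ r * n /2⌉
    ∎
  where
  open ≡-Reasoning
  row : ℕ → ℕ
  row m = ∑[ b < n ] 𝟙 (even (m + toℕ b))
  rows-pair : ∀ m → row m + row (suc m) ≡ n
  rows-pair m = trans (sym (∑-distrib-+ (λ (b : Fin n) → 𝟙 (even (m + toℕ b))) _))
    (trans (sum-cong-≗ (λ (b : Fin n) → 𝟙-not (even (m + toℕ b)))) (trans (∑-const n 1) (*-identityʳ n)))

module Checkerboard (r k : ℕ) where

  open KCycle r (suc k)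

  S₀ : Subset (r * suc (suc k))
  S₀ = checkerboard r (suc (suc k))

  column-balance : ∀ b → column (∁ S₀) b ≤ column S₀ b + 𝟙 (not (even (toℕ b)))
  column-balance b = begin
    column (∁ S₀) b
      ≡⟨ sum-cong-≗ (λ (c : Fin r) → cong 𝟙 (trans (lookup-map (combine c b) not S₀)
                                                    (cong not (lookup-checkerboard c b)))) ⟩
    ∑[ c < r ] 𝟙 (not (even (toℕ c + toℕ b)))
      ≡⟨ count-alternating (λ m → not (even (m + toℕ b))) (λ _ → refl) r ⟩
    (if not (even (toℕ b)) then ⌈ r /2⌉ else ⌊ r /2⌋)
      ≤⟨ halves-balance (even (toℕ b)) ⟩
    (if even (toℕ b) then ⌈ r /2⌉ else ⌊ r /2⌋) + 𝟙 (not (even (toℕ b)))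
      ≡⟨ cong (_+ _) (count-alternating (λ m → even (m + toℕ b)) (λ _ → refl) r) ⟨
    ∑[ c < r ] 𝟙 (even (toℕ c + toℕ b)) + 𝟙 (not (even (toℕ b)))
      ≡⟨ cong (_+ _) (sum-cong-≗ λ (c : Fin r) → cong 𝟙 (lookup-checkerboard c b)) ⟨
    column S₀ b + 𝟙 (not (even (toℕ b)))
      ∎
    where
    open ≤-Reasoning
    halves-balance : ∀ e → (if not e then ⌈ r /2⌉ else ⌊ r /2⌋)
                         ≤ (if e then ⌈ r /2⌉ else ⌊ r /2⌋) + 𝟙 (not e)
    halves-balance true  = ≤-trans (⌊n/2⌋≤⌈n/2⌉ r) (m≤m+n _ 0)
    halves-balance false = ⌈n/2⌉≤⌊n/2⌋+1 r

  ∉S₀⇒odd : ∀ (a : Fin r) (b : Fin (suc (suc k))) →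
    lookup S₀ (combine a b) ≡ false → even (toℕ a + toℕ b) ≡ false
  ∉S₀⇒odd a b ab∉S₀ = trans (sym (lookup-checkerboard a b)) ab∉S₀

  1≤rowNeighbours : ∀ a b → lookup S₀ (combine a b) ≡ false → 1 ≤ rowNeighbours S₀ a b
  1≤rowNeighbours a b ab∉S₀ with opposite-parity-neighbour b
  ... | d , b~d , d-flip = subst (_≤ rowNeighbours S₀ a b)
    (cong₂ (λ p q → 𝟙 (p ∧ q)) b~d (begin
      lookup S₀ (combine a d)    ≡⟨ lookup-checkerboard a d ⟩
      even (toℕ a + toℕ d)       ≡⟨ even-+-flip (toℕ a) d-flip ⟩
      not (even (toℕ a + toℕ b)) ≡⟨ cong not (∉S₀⇒odd a b ab∉S₀) ⟩
      true                       ∎))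
    (term≤∑ (λ d → 𝟙 (adj (C (suc (suc k))) b d ∧ lookup S₀ (combine a d))) d)
    where open ≡-Reasoning

  neighbour-balance : ∀ a b → lookup S₀ (combine a b) ≡ false →
    𝟙 (not (even (toℕ b))) + rowNeighbours (∁ S₀) a b ≤ rowNeighbours S₀ a b
  neighbour-balance a b ab∉S₀ with even (toℕ b) in b-parity
  ... | true  = 1≤m⇒m+n≤2⇒n≤m (1≤rowNeighbours a b ab∉S₀) (rowNeighbours≤2 S₀ a b)
  ... | false = subst (λ y → suc y ≤ rowNeighbours S₀ a b) (sym y≡0) (1≤rowNeighbours a b ab∉S₀)
    where
    y≡0 : rowNeighbours (∁ S₀) a b ≡ 0
    y≡0 = trans (sum-cong-≗ no-odd-neighbour) (sum-replicate-zero (suc (suc k)))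
      where
      no-odd-neighbour : ∀ d → 𝟙 (adj (C (suc (suc k))) b d ∧ lookup (∁ S₀) (combine a d)) ≡ 0
      no-odd-neighbour d with adj (C (suc (suc k))) b d in b~d
      ... | false = refl
      ... | true  = cong 𝟙 (trans (lookup-map (combine a d) not S₀) (cong not (begin
        lookup S₀ (combine a d)    ≡⟨ lookup-checkerboard a d ⟩
        even (toℕ a + toℕ d)       ≡⟨ even-+-flip (toℕ a) d-flip ⟩
        not (even (toℕ a + toℕ b)) ≡⟨ cong not (∉S₀⇒odd a b ab∉S₀) ⟩
        true                       ∎)))
        where
        open ≡-Reasoning
        d-flip : even (toℕ d) ≡ not (even (toℕ b))
        d-flip = trans (odd-neighbours-even b d b-parity b~d) (sym (cong not b-parity))

  offensive-at : ∀ a b → combine a b ∉ S₀ →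
    δ (K r □ C (suc (suc k))) S₀ (combine a b) ≥ suc (δ (K r □ C (suc (suc k))) (∁ S₀) (combine a b))
  offensive-at a b ab∉S₀ = Equivalence.from (offensive-at⇔ S₀ a b (∉⇒lookup≡false ab∉S₀)) (begin
    column (∁ S₀) b + rowNeighbours (∁ S₀) a b
      ≤⟨ +-monoˡ-≤ _ (column-balance b) ⟩
    column S₀ b + 𝟙 (not (even (toℕ b))) + rowNeighbours (∁ S₀) a b
      ≡⟨ +-assoc (column S₀ b) _ _ ⟩
    column S₀ b + (𝟙 (not (even (toℕ b))) + rowNeighbours (∁ S₀) a b)
      ≤⟨ +-monoʳ-≤ (column S₀ b) (neighbour-balance a b (∉⇒lookup≡false ab∉S₀)) ⟩
    column S₀ b + rowNeighbours S₀ a b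
      ∎)
    where open ≤-Reasoning

  offensive : ∀ v → v ∉ S₀ → δ (K r □ C (suc (suc k))) S₀ v ≥ suc (δ (K r □ C (suc (suc k))) (∁ S₀) v)
  offensive v = subst Offensive (combine-remQuot {r} (suc (suc k)) v) (offensive-at _ _)
    where
    Offensive : Fin (r * suc (suc k)) → Set
    Offensive v = v ∉ S₀ → δ (K r □ C (suc (suc k))) S₀ v ≥ suc (δ (K r □ C (suc (suc k))) (∁ S₀) v)

proposition19 : (r t : ℕ) → r ≥ 1 → t ≥ 3 →
    OffensiveAllianceNumber (K r □ C t) ⌈ r * t /2⌉
proposition19 zero    _             ()  _
proposition19 _       zero          _   ()
proposition19 _       (suc zero)    _   (s≤s ())
-- t = 2 lands here too: the argument only needs t ≥ 2.
proposition19 (suc r) (suc (suc k)) _   _ =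
  ( checkerboard (suc r) (suc (suc k))
  , (checkerboard-nonempty {r} {suc k} , Checkerboard.offensive (suc r) k)
  , ∣checkerboard∣ (suc r) (suc (suc k)) )
  , KCycle.lower-bound (suc r) (suc k)
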